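{- Let $T$ be a finite set of tense formulas with $\top,\bot\in T$. For any $\varphi,\psi\in T^\circ$: (1) $[\![\varphi]\!]\subseteq[\![\psi]\!]$ if and only if $G(\varphi)\subseteq G(\psi)$; (2) if $\mathsf{G}\vdash\varphi\Rightarrow_{T^\circ}\psi$, then $[\![\varphi]\!]\subseteq[\![\psi]\!]$; (3) the set $[\![T^\circ]\!]=\{[\![\chi]\!]\mid\chi\in T^\circ\}$ is finite; (4) $[\![\varphi]\!]\leq^\circ[\![\psi]\!]$ if and only if $[\![\varphi]\!]\subseteq[\![\psi]\!]$; (5) $[\![\varphi\wedge\psi]\!]=[\![\varphi]\!]\cap[\![\psi]\!]$.
   Context: Tense formulas are built from a countable set of propositional variables using $\bot,\top$, unary $\neg,\Diamond,\blacksquare$ and binary $\wedge,\vee$; $\Diamond^0\varphi=\varphi$, $\Diamond^{k+1}\varphi=\Diamond\Diamond^k\varphi$. Formula structures: $\langle\varphi\rangle^n$ is the formal expression obtained by applying a unary structural operator $\langle\cdot\rangle$ $n$ times to the formula $\varphi$ ($\langle\varphi\rangle^0=\varphi$); if $\Gamma=\langle\varphi\rangle^n$ then $\langle\Gamma\rangle^k=\langle\varphi\rangle^{n+k}$. For a set of formulas $X$, $FS(X)=\{\langle\varphi\rangle^n\mid\varphi\in X,\ n\geq0\}$. A sequent is $\Gamma\Rightarrow\psi$, $\Gamma$ a formula structure, $\psi$ a formula. The calculus $\mathsf{G}$ has axioms (arbitrary formulas, $n\geq0$): $\varphi\Rightarrow\varphi$; $\varphi\wedge(\psi\vee\chi)\Rightarrow(\varphi\wedge\psi)\vee(\varphi\wedge\chi)$;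 $\varphi\Rightarrow\top$; $\langle\bot\rangle^n\Rightarrow\psi$; $\varphi\wedge\neg\varphi\Rightarrow\bot$; $\top\Rightarrow\varphi\vee\neg\varphi$; $\Diamond^3\varphi\Rightarrow\Diamond^2\varphi$; and rules (arbitrary $n\geq0$): from $\langle\varphi_i\rangle^n\Rightarrow\psi$ infer $\langle\varphi_1\wedge\varphi_2\rangle^n\Rightarrow\psi$ ($i=1,2$); from $\Gamma\Rightarrow\psi_1$, $\Gamma\Rightarrow\psi_2$ infer $\Gamma\Rightarrow\psi_1\wedge\psi_2$; from $\langle\varphi_1\rangle^n\Rightarrow\psi$, $\langle\varphi_2\rangle^n\Rightarrow\psi$ infer $\langle\varphi_1\vee\varphi_2\rangle^n\Rightarrow\psi$; from $\Gamma\Rightarrow\psi_i$ infer $\Gamma\Rightarrow\psi_1\vee\psi_2$; from $\langle\varphi\rangle^{n+1}\Rightarrow\psi$ infer $\langle\Diamond\varphi\rangle^n\Rightarrow\psi$; from $\Gamma\Rightarrow\psi$ infer $\langle\Gamma\rangle\Rightarrow\Diamond\psi$; from $\langle\varphi\rangle^n\Rightarrow\psi$ infer $\langle\blacksquare\varphi\rangle^{n+1}\Rightarrow\psi$; from $\langle\Gamma\rangle\Rightarrow\psi$ infer $\Gamma\Rightarrow\blacksquare\psi$; from $\Gamma\Rightarrow\varphi$ and $\langle\varphi\rangle^n\Rightarrow\psi$ infer $\langle\Gamma\rangle^n\Rightarrow\psi$ (Cut). A derivation is a finite tree of sequents each node of which is an axiom instance or obtained from its children by a rule. $T^\Diamond=\{\Diamond^k\varphi\mid\varphi\in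 T,\ 0\leq k\leq 3\}$; $T^\circ$ is the smallest set of formulas containing $T^\Diamond$ and closed under $\neg,\wedge,\vee$; $T^\bullet=T^\circ\setminus T^\Diamond$. $\mathsf{G}\vdash\Gamma\Rightarrow_{T^\circ}\psi$ means there is a derivation of $\Gamma\Rightarrow\psi$ in $\mathsf{G}$ all of whose formulas lie in $T^\circ$. For $\varphi\in T^\circ$: $G(\varphi)=\{\langle\chi\rangle^n\in FS(T^\Diamond)\mid\mathsf{G}\vdash\langle\chi\rangle^n\Rightarrow_{T^\circ}\varphi\}$ and $[\![\varphi]\!]=G(\varphi)\cup FS(T^\bullet)$. On $[\![T^\circ]\!]$ define $[\![\varphi]\!]\wedge^\circ[\![\psi]\!]=[\![\varphi\wedge\psi]\!]$ and $[\![\varphi]\!]\leq^\circ[\![\psi]\!]$ iff $[\![\varphi]\!]\wedge^\circ[\![\psi]\!]=[\![\varphi]\!]$. -}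

module Defs where

open import Data.Nat using (ℕ; zero; suc; _+_; _≤_)
open import Data.Product using (Σ; _×_; _,_; ∃-syntax)
open import Data.Sum using (_⊎_)
open import Data.List using (List)
open import Data.List.Membership.Propositional using (_∈_)
open import Relation.Binary.PropositionalEquality using (_≡_)
open import Relation.Nullary using (¬_)

data Fm : Set where
  var  : ℕ → Fm
  bot  : Fm
  top  : Fm
  neg  : Fm → Fm
  _∧'_ : Fm → Fm → Fm
  _∨'_ : Fm → Fm → Fm
  ◇    : Fm → Fm
  ■    : Fm → Fm

infixr 6 _∧'_
infixr 5 _∨'_

◇^ : ℕ → Fm → Fm
◇^ zero    φ = φ
◇^ (suc k) φ = ◇ (◇^ k φ)

-- Formula structures: ⟨ φ ⟩^ n  (φ under n structural brackets)

record FStr : Set where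
  constructor ⟨_⟩^_
  field
    fm  : Fm
    lev : ℕ
open FStr public

⟪_⟫^_ : FStr → ℕ → FStr
⟪ ⟨ φ ⟩^ n ⟫^ k = ⟨ φ ⟩^ (n + k)

-- The calculus G, with every formula of every sequent in the
-- derivation required to lie in the set P.
-- P ⊢ Γ ⇒ ψ : a derivation of Γ ⇒ ψ all of whose formulas are in P.

mutual
  data _⊢_⇒_ (P : Fm → Set) : FStr → Fm → Set where
    node : ∀ {Γ ψ} → P (fm Γ) → P ψ → Step P Γ ψ → P ⊢ Γ ⇒ ψ

  data Step (P : Fm → Set) : FStr → Fm → Set where
    ax-id    : ∀ {φ} → Step P (⟨ φ ⟩^ 0) φ
    ax-dist  : ∀ {φ ψ χ} →
               Step P (⟨ φ ∧' (ψ ∨' χ) ⟩^ 0) ((φ ∧' ψ) ∨' (φ ∧' χ))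
    ax-top   : ∀ {φ} → Step P (⟨ φ ⟩^ 0) top
    ax-bot   : ∀ {n ψ} → Step P (⟨ bot ⟩^ n) ψ
    ax-contr : ∀ {φ} → Step P (⟨ φ ∧' neg φ ⟩^ 0) bot
    ax-lem   : ∀ {φ} → Step P (⟨ top ⟩^ 0) (φ ∨' neg φ)
    ax-◇     : ∀ {φ} → Step P (⟨ ◇^ 3 φ ⟩^ 0) (◇^ 2 φ)
    ∧L₁ : ∀ {φ₁ φ₂ n ψ} → P ⊢ ⟨ φ₁ ⟩^ n ⇒ ψ → Step P (⟨ φ₁ ∧' φ₂ ⟩^ n) ψ
    ∧L₂ : ∀ {φ₁ φ₂ n ψ} → P ⊢ ⟨ φ₂ ⟩^ n ⇒ ψ → Step P (⟨ φ₁ ∧' φ₂ ⟩^ n) ψ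
    ∧R  : ∀ {Γ ψ₁ ψ₂} → P ⊢ Γ ⇒ ψ₁ → P ⊢ Γ ⇒ ψ₂ → Step P Γ (ψ₁ ∧' ψ₂)
    ∨L  : ∀ {φ₁ φ₂ n ψ} → P ⊢ ⟨ φ₁ ⟩^ n ⇒ ψ → P ⊢ ⟨ φ₂ ⟩^ n ⇒ ψ →
          Step P (⟨ φ₁ ∨' φ₂ ⟩^ n) ψ
    ∨R₁ : ∀ {Γ ψ₁ ψ₂} → P ⊢ Γ ⇒ ψ₁ → Step P Γ (ψ₁ ∨' ψ₂)
    ∨R₂ : ∀ {Γ ψ₁ ψ₂} → P ⊢ Γ ⇒ ψ₂ → Step P Γ (ψ₁ ∨' ψ₂)
    ◇L  : ∀ {φ n ψ} → P ⊢ ⟨ φ ⟩^ (suc n) ⇒ ψ → Step P (⟨ ◇ φ ⟩^ n) ψ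
    ◇R  : ∀ {Γ ψ} → P ⊢ Γ ⇒ ψ → Step P (⟪ Γ ⟫^ 1) (◇ ψ)
    ■L  : ∀ {φ n ψ} → P ⊢ ⟨ φ ⟩^ n ⇒ ψ → Step P (⟨ ■ φ ⟩^ (suc n)) ψ
    ■R  : ∀ {Γ ψ} → P ⊢ ⟪ Γ ⟫^ 1 ⇒ ψ → Step P Γ (■ ψ)
    cut : ∀ {Γ φ n ψ} → P ⊢ Γ ⇒ φ → P ⊢ ⟨ φ ⟩^ n ⇒ ψ → Step P (⟪ Γ ⟫^ n) ψ

Subset : Set → Set₁
Subset A = A → Set

_⊆_ : {A : Set} → Subset A → Subset A → Set
X ⊆ Y = ∀ {a} → X a → Y a

_≐_ : {A : Set} → Subset A → Subset A → Set
X ≐ Y = (X ⊆ Y) × (Y ⊆ X)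

_∩_ : {A : Set} → Subset A → Subset A → Subset A
(X ∩ Y) a = X a × Y a

FS : Subset Fm → Subset FStr
FS X Γ = X (fm Γ)

module _ (T : List Fm) where

  TDia : Subset Fm
  TDia φ = Σ Fm λ χ → (χ ∈ T) × (Σ ℕ λ k → (k ≤ 3) × (φ ≡ ◇^ k χ))

  data TCirc : Fm → Set where
    base : ∀ {φ} → TDia φ → TCirc φ
    c-neg : ∀ {φ} → TCirc φ → TCirc (neg φ)
    c-and : ∀ {φ ψ} → TCirc φ → TCirc ψ → TCirc (φ ∧' ψ)
    c-or  : ∀ {φ ψ} → TCirc φ → TCirc ψ → TCirc (φ ∨' ψ)

  TBullet : Subset Fm
  TBullet φ = TCirc φ × ¬ TDia φ

  Gset : Fm → Subset FStr
  Gset φ Γ = FS TDia Γ × (TCirc ⊢ Γ ⇒ φ)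

  ⟦_⟧ : Fm → Subset FStr
  ⟦ φ ⟧ Γ = Gset φ Γ ⊎ FS TBullet Γ

  -- [[φ]] ≤° [[ψ]]  iff  [[φ]] ∧° [[ψ]] = [[φ]], where [[φ]] ∧° [[ψ]] = [[φ ∧ ψ]]
  _≤°_ : Fm → Fm → Set
  φ ≤° ψ = ⟦ φ ∧' ψ ⟧ ≐ ⟦ φ ⟧

  -- {[[χ]] | χ ∈ T°} is finite: finitely many χ's in T° whose
  -- denotations exhaust it (up to extensional set equality)
  FiniteDenotations : Set
  FiniteDenotations =
    Σ (List Fm) λ L → ((∀ {χ} → χ ∈ L → TCirc χ) ×
      (∀ χ → TCirc χ → Σ Fm λ χ' → (χ' ∈ L) × (⟦ χ ⟧ ≐ ⟦ χ' ⟧)))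

module Submission where

-- Parts (1), (2), (4), (5) are direct: FS(T•) is a summand common to all
-- denotations and disjoint from every G(φ) ⊆ FS(T◇) (1); a derivable φ ⇒ ψ
-- can be cut onto any derivation of Γ ⇒ φ (2); ∧L and ∧R make ⟦φ ∧ ψ⟧ the
-- intersection ⟦φ⟧ ∩ ⟦ψ⟧ (5); and (4) is the set-theoretic fact that X ∩ Y
-- equals X exactly when X ⊆ Y.
--
-- Inside a set P closed under ¬, ∧, ∨ and
-- containing ⊤, ⊥, derivability is a preorder whose quotient is a Boolean
-- algebra.  Over a finite list of atoms every Boolean combination is then
-- provably equivalent to a decision tree (iterated case splits "if a then …
-- else …" with leaves ⊤, ⊥), and there are finitely many trees.  Since T° is
-- the Boolean closure of the finite set T◇, and provably equivalent formulas
-- have equal denotations by (2), only finitely many denotations arise.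

open import Defs
open import Data.Nat using (z≤n; s≤s)
open import Data.Nat.Properties using (+-identityʳ; ≤-pred)
open import Data.Product using (Σ; _×_; _,_; proj₁; proj₂)
open import Data.Sum using (inj₁; inj₂)
open import Data.Empty using (⊥-elim)
open import Data.List using (List; []; _∷_; map; concatMap; upTo; cartesianProductWith)
open import Data.List.Membership.Propositional using (_∈_; mapWith∈; lose; find)
open import Data.List.Membership.Propositional.Properties
  using (∈-map⁺; ∈-map⁻; ∈-concatMap⁺; ∈-concatMap⁻; ∈-upTo⁺; ∈-upTo⁻; ∈-cartesianProductWith⁺)
open import Data.List.Relation.Unary.Any using (Any; here; there)
open import Data.List.Relation.Unary.Any.Properties using (mapWith∈⁺)
open import Relation.Binary.PropositionalEquality using (_≡_; refl; sym; subst; isEquivalence)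
open import Relation.Binary.Bundles using (Preorder)
import Relation.Binary.Reasoning.Preorder as PreorderReasoning
open import Function.Base using (_∘_)
open import Function.Bundles using (_⇔_; mk⇔)

≐∩⇒[≐⇔⊆] : {A : Set} {X Y Z : Subset A} → Z ≐ (X ∩ Y) → (Z ≐ X) ⇔ (X ⊆ Y)
≐∩⇒[≐⇔⊆] (Z⊆X∩Y , X∩Y⊆Z) =
  mk⇔ (λ (_ , X⊆Z) {_} x → proj₂ (Z⊆X∩Y (X⊆Z x)))
      (λ X⊆Y → (λ {_} z → proj₁ (Z⊆X∩Y z)) , (λ {_} x → X∩Y⊆Z (x , X⊆Y x)))

module _ {P : Fm → Set} where

  antecedent∈ : ∀ {Γ ψ} → P ⊢ Γ ⇒ ψ → P (fm Γ)
  antecedent∈ (node p _ _) = p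

  succedent∈ : ∀ {Γ ψ} → P ⊢ Γ ⇒ ψ → P ψ
  succedent∈ (node _ q _) = q

  cut₀ : ∀ {Γ φ ψ} → P ⊢ Γ ⇒ φ → P ⊢ ⟨ φ ⟩^ 0 ⇒ ψ → P ⊢ Γ ⇒ ψ
  cut₀ {⟨ χ ⟩^ n} {ψ = ψ} d e =
    subst (λ m → P ⊢ ⟨ χ ⟩^ m ⇒ ψ) (+-identityʳ n)
          (node (antecedent∈ d) (succedent∈ e) (cut d e))

module Lattice (P : Fm → Set)
               (∧-closed : ∀ {φ ψ} → P φ → P ψ → P (φ ∧' ψ))
               (∨-closed : ∀ {φ ψ} → P φ → P ψ → P (φ ∨' ψ)) where

  record Elem : Set where
    constructor elem
    field
      formula : Fm
      member  : P formula
  open Elem public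

  infixr 7 _⊓_
  infixr 6 _⊔_

  _⊓_ : Elem → Elem → Elem
  x ⊓ y = elem (formula x ∧' formula y) (∧-closed (member x) (member y))

  _⊔_ : Elem → Elem → Elem
  x ⊔ y = elem (formula x ∨' formula y) (∨-closed (member x) (member y))

  infix 4 _≼_ _≈_
  record _≼_ (x y : Elem) : Set where
    constructor derive
    field
      derivation : P ⊢ ⟨ formula x ⟩^ 0 ⇒ formula y
  open _≼_ public

  by : ∀ {x y} → Step P (⟨ formula x ⟩^ 0) (formula y) → x ≼ y
  by {x} {y} s = derive (node (member x) (member y) s)

  ≼-reflexive : ∀ {x y} → formula x ≡ formula y → x ≼ y
  ≼-reflexive refl = by ax-id

  ≼-refl : ∀ {x} → x ≼ x
  ≼-refl = ≼-reflexive refl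

  ≼-trans : ∀ {x y z} → x ≼ y → y ≼ z → x ≼ z
  ≼-trans (derive d) (derive e) = derive (cut₀ d e)

  ≼-preorder : Preorder _ _ _
  ≼-preorder = record
    { Carrier    = Elem
    ; _≈_        = _≡_
    ; _≲_        = _≼_
    ; isPreorder = record
      { isEquivalence = isEquivalence
      ; reflexive     = λ { refl → ≼-refl }
      ; trans         = ≼-trans
      }
    }

  module ≼-Reasoning = PreorderReasoning ≼-preorder

  _≈_ : Elem → Elem → Set
  x ≈ y = (x ≼ y) × (y ≼ x)

  ≈-sym : ∀ {x y} → x ≈ y → y ≈ x
  ≈-sym (x≼y , y≼x) = y≼x , x≼y

  ≈-trans : ∀ {x y z} → x ≈ y → y ≈ z → x ≈ z
  ≈-trans (x≼y , y≼x) (y≼z , z≼y) = ≼-trans x≼y y≼z , ≼-trans z≼y y≼x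

  lb₁ : ∀ x y → x ⊓ y ≼ x
  lb₁ x y = by (∧L₁ (derivation (≼-refl {x})))

  lb₂ : ∀ x y → x ⊓ y ≼ y
  lb₂ x y = by (∧L₂ (derivation (≼-refl {y})))

  glb : ∀ {z x y} → z ≼ x → z ≼ y → z ≼ x ⊓ y
  glb (derive d) (derive e) = by (∧R d e)

  ub₁ : ∀ x y → x ≼ x ⊔ y
  ub₁ x y = by (∨R₁ (derivation (≼-refl {x})))

  ub₂ : ∀ x y → y ≼ x ⊔ y
  ub₂ x y = by (∨R₂ (derivation (≼-refl {y})))

  lub : ∀ {x y z} → x ≼ z → y ≼ z → x ⊔ y ≼ z
  lub (derive d) (derive e) = by (∨L d e)

  distrib : ∀ x y z → x ⊓ (y ⊔ z) ≼ x ⊓ y ⊔ x ⊓ z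
  distrib x y z = by ax-dist

  ⊓-mono : ∀ {x y x' y'} → x ≼ x' → y ≼ y' → x ⊓ y ≼ x' ⊓ y'
  ⊓-mono {x} {y} d e = glb (≼-trans (lb₁ x y) d) (≼-trans (lb₂ x y) e)

  ⊔-mono : ∀ {x y x' y'} → x ≼ x' → y ≼ y' → x ⊔ y ≼ x' ⊔ y'
  ⊔-mono {x' = x'} {y'} d e = lub (≼-trans d (ub₁ x' y')) (≼-trans e (ub₂ x' y'))

  ⊓-cong : ∀ {x y x' y'} → x ≈ x' → y ≈ y' → x ⊓ y ≈ x' ⊓ y'
  ⊓-cong (d , d') (e , e') = ⊓-mono d e , ⊓-mono d' e'

  ⊔-cong : ∀ {x y x' y'} → x ≈ x' → y ≈ y' → x ⊔ y ≈ x' ⊔ y'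
  ⊔-cong (d , d') (e , e') = ⊔-mono d e , ⊔-mono d' e'

  ⊓-comm : ∀ x y → x ⊓ y ≼ y ⊓ x
  ⊓-comm x y = glb (lb₂ x y) (lb₁ x y)

  ⊔⊓-elim : ∀ {u v c w} → u ⊓ c ≼ w → v ⊓ c ≼ w → (u ⊔ v) ⊓ c ≼ w
  ⊔⊓-elim {u} {v} {c} {w} d e = begin
    (u ⊔ v) ⊓ c         ≲⟨ ⊓-comm (u ⊔ v) c ⟩
    c ⊓ (u ⊔ v)         ≲⟨ distrib c u v ⟩
    c ⊓ u ⊔ c ⊓ v       ≲⟨ lub (≼-trans (⊓-comm c u) d) (≼-trans (⊓-comm c v) e) ⟩
    w                   ∎
    where open ≼-Reasoning

  module Boolean (top∈ : P top) (bot∈ : P bot)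
                 (neg-closed : ∀ {φ} → P φ → P (neg φ)) where

    ⊤ᴱ ⊥ᴱ : Elem
    ⊤ᴱ = elem top top∈
    ⊥ᴱ = elem bot bot∈

    ∁ : Elem → Elem
    ∁ x = elem (neg (formula x)) (neg-closed (member x))

    ≼⊤ : ∀ {x} → x ≼ ⊤ᴱ
    ≼⊤ = by ax-top

    ⊥≼ : ∀ {x} → ⊥ᴱ ≼ x
    ⊥≼ = by ax-bot

    Complement : Elem → Elem → Set
    Complement x y = (x ⊓ y ≼ ⊥ᴱ) × (⊤ᴱ ≼ x ⊔ y)

    ∁-complement : ∀ x → Complement x (∁ x)
    ∁-complement x = by ax-contr , by ax-lem

    complement-unique : ∀ {x y y'} → Complement x y → Complement x y' → y ≼ y'
    complement-unique {x} {y} {y'} (disjoint , _) (_ , exhaustive') = begin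
      y                   ≲⟨ glb ≼-refl (≼-trans ≼⊤ exhaustive') ⟩
      y ⊓ (x ⊔ y')        ≲⟨ distrib y x y' ⟩
      y ⊓ x ⊔ y ⊓ y'      ≲⟨ lub (≼-trans (⊓-comm y x) (≼-trans disjoint ⊥≼)) (lb₂ y y') ⟩
      y'                  ∎
      where open ≼-Reasoning

    complement-resp-≈ : ∀ {x x' y} → x ≈ x' → Complement x y → Complement x' y
    complement-resp-≈ (x≼x' , x'≼x) (disjoint , exhaustive) =
      ≼-trans (⊓-mono x'≼x ≼-refl) disjoint , ≼-trans exhaustive (⊔-mono x≼x' ≼-refl)

    complement≈∁ : ∀ {x y} → Complement x y → y ≈ ∁ x
    complement≈∁ {x} c = complement-unique c (∁-complement x) , complement-unique (∁-complement x) c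

    ∁-cong : ∀ {x x'} → x ≈ x' → ∁ x ≈ ∁ x'
    ∁-cong {x} {x'} x≈x' = ≈-sym (complement≈∁ (complement-resp-≈ (≈-sym x≈x') (∁-complement x')))

    clash : ∀ {z a w} → z ≼ a → z ≼ ∁ a → z ≼ w
    clash {a = a} d e = ≼-trans (glb d e) (≼-trans (proj₁ (∁-complement a)) ⊥≼)

    cases : ∀ {z w} a → z ⊓ a ≼ w → z ⊓ ∁ a ≼ w → z ≼ w
    cases {z} {w} a d e = begin
      z                   ≲⟨ glb ≼-refl (≼-trans ≼⊤ (proj₂ (∁-complement a))) ⟩
      z ⊓ (a ⊔ ∁ a)       ≲⟨ distrib z a (∁ a) ⟩
      z ⊓ a ⊔ z ⊓ ∁ a     ≲⟨ lub d e ⟩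
      w                   ∎
      where open ≼-Reasoning

    -- The conditional "if a then p else q" = (a ∧ p) ∨ (¬a ∧ q).  For fixed
    -- a it is a Boolean homomorphism in the pair (p, q).

    ite : Elem → Elem → Elem → Elem
    ite a p q = a ⊓ p ⊔ ∁ a ⊓ q

    ite-intro : ∀ {z a p q} → z ⊓ a ≼ p → z ⊓ ∁ a ≼ q → z ≼ ite a p q
    ite-intro {z} {a} {p} {q} d e =
      cases a (≼-trans (glb (lb₂ z a) d) (ub₁ (a ⊓ p) (∁ a ⊓ q)))
              (≼-trans (glb (lb₂ z (∁ a)) e) (ub₂ (a ⊓ p) (∁ a ⊓ q)))

    ite-then : ∀ a p q → ite a p q ⊓ a ≼ p
    ite-then a p q =
      ⊔⊓-elim (≼-trans (lb₁ (a ⊓ p) a) (lb₂ a p))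
              (clash (lb₂ (∁ a ⊓ q) a) (≼-trans (lb₁ (∁ a ⊓ q) a) (lb₁ (∁ a) q)))

    ite-else : ∀ a p q → ite a p q ⊓ ∁ a ≼ q
    ite-else a p q =
      ⊔⊓-elim (clash (≼-trans (lb₁ (a ⊓ p) (∁ a)) (lb₁ a p)) (lb₂ (a ⊓ p) (∁ a)))
              (≼-trans (lb₁ (∁ a ⊓ q) (∁ a)) (lb₂ (∁ a) q))

    ite-mono : ∀ {a p q p' q'} → p ≼ p' → q ≼ q' → ite a p q ≼ ite a p' q'
    ite-mono d e = ⊔-mono (⊓-mono ≼-refl d) (⊓-mono ≼-refl e)

    ite-cong : ∀ {a p q p' q'} → p ≈ p' → q ≈ q' → ite a p q ≈ ite a p' q'
    ite-cong (d , d') (e , e') = ite-mono d e , ite-mono d' e'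

    ite-idem : ∀ a p → ite a p p ≈ p
    ite-idem a p = lub (lb₂ a p) (lb₂ (∁ a) p) , ite-intro (lb₁ p a) (lb₁ p (∁ a))

    ite-atom : ∀ a → ite a ⊤ᴱ ⊥ᴱ ≈ a
    ite-atom a = lub (lb₁ a ⊤ᴱ) (≼-trans (lb₂ (∁ a) ⊥ᴱ) ⊥≼)
               , ≼-trans (glb ≼-refl ≼⊤) (ub₁ (a ⊓ ⊤ᴱ) (∁ a ⊓ ⊥ᴱ))

    ite-⊓ : ∀ a p q p' q' → ite a p q ⊓ ite a p' q' ≈ ite a (p ⊓ p') (q ⊓ q')
    ite-⊓ a p q p' q' =
      ite-intro (glb (≼-trans (⊓-mono (lb₁ N N') ≼-refl) (ite-then a p q))
                     (≼-trans (⊓-mono (lb₂ N N') ≼-refl) (ite-then a p' q')))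
                (glb (≼-trans (⊓-mono (lb₁ N N') ≼-refl) (ite-else a p q))
                     (≼-trans (⊓-mono (lb₂ N N') ≼-refl) (ite-else a p' q'))) ,
      glb (ite-mono (lb₁ p p') (lb₁ q q')) (ite-mono (lb₂ p p') (lb₂ q q'))
      where
        N  = ite a p q
        N' = ite a p' q'

    ite-⊔ : ∀ a p q p' q' → ite a p q ⊔ ite a p' q' ≈ ite a (p ⊔ p') (q ⊔ q')
    ite-⊔ a p q p' q' =
      lub (ite-mono (ub₁ p p') (ub₁ q q')) (ite-mono (ub₂ p p') (ub₂ q q')) ,
      lub (≼-trans (distrib a p p') (⊔-mono (ub₁ (a ⊓ p) (∁ a ⊓ q)) (ub₁ (a ⊓ p') (∁ a ⊓ q'))))
          (≼-trans (distrib (∁ a) q q') (⊔-mono (ub₂ (a ⊓ p) (∁ a ⊓ q)) (ub₂ (a ⊓ p') (∁ a ⊓ q'))))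

    ite-complement : ∀ {a p q p' q'} → Complement p p' → Complement q q' →
                     Complement (ite a p q) (ite a p' q')
    ite-complement {a} {p} {q} {p'} {q'} (disjoint₁ , exhaustive₁) (disjoint₂ , exhaustive₂) =
      ≼-trans (proj₁ (ite-⊓ a p q p' q')) (≼-trans (ite-mono disjoint₁ disjoint₂) (proj₁ (ite-idem a ⊥ᴱ))) ,
      ≼-trans (proj₂ (ite-idem a ⊤ᴱ)) (≼-trans (ite-mono exhaustive₁ exhaustive₂) (proj₂ (ite-⊔ a p q p' q')))

    data Tree : List Elem → Set where
      true false : Tree []
      branch     : ∀ {a As} → Tree As → Tree As → Tree (a ∷ As)

    ⌊_⌋ : ∀ {As} → Tree As → Elem
    ⌊ true ⌋           = ⊤ᴱ
    ⌊ false ⌋          = ⊥ᴱ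
    ⌊ branch {a} s t ⌋ = ite a ⌊ s ⌋ ⌊ t ⌋

    trees : ∀ As → List (Tree As)
    trees []       = true ∷ false ∷ []
    trees (a ∷ As) = cartesianProductWith branch (trees As) (trees As)

    trees-complete : ∀ {As} (t : Tree As) → t ∈ trees As
    trees-complete true         = here refl
    trees-complete false        = there (here refl)
    trees-complete (branch s t) =
      ∈-cartesianProductWith⁺ branch (trees-complete s) (trees-complete t)

    constant : ∀ As → Tree [] → Tree As
    constant []       leaf = leaf
    constant (a ∷ As) leaf = branch (constant As leaf) (constant As leaf)

    constant-sound : ∀ As (leaf : Tree []) → ⌊ constant As leaf ⌋ ≈ ⌊ leaf ⌋
    constant-sound []       leaf = ≼-refl , ≼-refl
    constant-sound (a ∷ As) leaf =
      ≈-trans (ite-idem a ⌊ constant As leaf ⌋) (constant-sound As leaf)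

    select : ∀ {φ As} → Any (λ a → formula a ≡ φ) As → Tree As
    select {As = a ∷ As} (here _) = branch (constant As true) (constant As false)
    select (there i)              = branch (select i) (select i)

    select-sound : ∀ {φ As} (i : Any (λ a → formula a ≡ φ) As) (p : P φ) →
                   ⌊ select i ⌋ ≈ elem φ p
    select-sound {As = a ∷ As} (here eq) p =
      ≈-trans (ite-cong (constant-sound As true) (constant-sound As false))
              (≈-trans (ite-atom a) (≼-reflexive eq , ≼-reflexive (sym eq)))
    select-sound {As = a ∷ _} (there i) p =
      ≈-trans (ite-idem a ⌊ select i ⌋) (select-sound i p)

    _∧ᵗ_ : ∀ {As} → Tree As → Tree As → Tree As
    true       ∧ᵗ t           = t
    false      ∧ᵗ t           = false
    branch s t ∧ᵗ branch s' t' = branch (s ∧ᵗ s') (t ∧ᵗ t')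

    _∨ᵗ_ : ∀ {As} → Tree As → Tree As → Tree As
    true       ∨ᵗ t           = true
    false      ∨ᵗ t           = t
    branch s t ∨ᵗ branch s' t' = branch (s ∨ᵗ s') (t ∨ᵗ t')

    ¬ᵗ : ∀ {As} → Tree As → Tree As
    ¬ᵗ true         = false
    ¬ᵗ false        = true
    ¬ᵗ (branch s t) = branch (¬ᵗ s) (¬ᵗ t)

    ∧ᵗ-sound : ∀ {As} (s t : Tree As) → ⌊ s ∧ᵗ t ⌋ ≈ ⌊ s ⌋ ⊓ ⌊ t ⌋
    ∧ᵗ-sound true  t = glb ≼⊤ ≼-refl , lb₂ ⊤ᴱ ⌊ t ⌋
    ∧ᵗ-sound false t = ⊥≼ , lb₁ ⊥ᴱ ⌊ t ⌋
    ∧ᵗ-sound (branch {a} s t) (branch s' t') =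
      ≈-trans (ite-cong (∧ᵗ-sound s s') (∧ᵗ-sound t t'))
              (≈-sym (ite-⊓ a ⌊ s ⌋ ⌊ t ⌋ ⌊ s' ⌋ ⌊ t' ⌋))

    ∨ᵗ-sound : ∀ {As} (s t : Tree As) → ⌊ s ∨ᵗ t ⌋ ≈ ⌊ s ⌋ ⊔ ⌊ t ⌋
    ∨ᵗ-sound true  t = ub₁ ⊤ᴱ ⌊ t ⌋ , ≼⊤
    ∨ᵗ-sound false t = ub₂ ⊥ᴱ ⌊ t ⌋ , lub ⊥≼ ≼-refl
    ∨ᵗ-sound (branch {a} s t) (branch s' t') =
      ≈-trans (ite-cong (∨ᵗ-sound s s') (∨ᵗ-sound t t'))
              (≈-sym (ite-⊔ a ⌊ s ⌋ ⌊ t ⌋ ⌊ s' ⌋ ⌊ t' ⌋))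

    ¬ᵗ-complement : ∀ {As} (t : Tree As) → Complement ⌊ t ⌋ ⌊ ¬ᵗ t ⌋
    ¬ᵗ-complement true         = lb₂ ⊤ᴱ ⊥ᴱ , ub₁ ⊤ᴱ ⊥ᴱ
    ¬ᵗ-complement false        = lb₁ ⊥ᴱ ⊤ᴱ , ub₂ ⊥ᴱ ⊤ᴱ
    ¬ᵗ-complement (branch s t) = ite-complement (¬ᵗ-complement s) (¬ᵗ-complement t)

    ¬ᵗ-sound : ∀ {As} (t : Tree As) → ⌊ ¬ᵗ t ⌋ ≈ ∁ ⌊ t ⌋
    ¬ᵗ-sound t = complement≈∁ (¬ᵗ-complement t)

module Denotations (T : List Fm) where

  open Lattice (TCirc T) c-and c-or

  ⟦⟧-mono : ∀ {φ ψ} → TCirc T ⊢ ⟨ φ ⟩^ 0 ⇒ ψ → ⟦_⟧ T φ ⊆ ⟦_⟧ T ψ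
  ⟦⟧-mono d (inj₁ (dia , e)) = inj₁ (dia , cut₀ e d)
  ⟦⟧-mono d (inj₂ bullet)    = inj₂ bullet

  -- (1) G(φ) lies in FS(T◇), which is disjoint from the common part FS(T•).
  ⟦⟧⊆⇒G⊆ : ∀ {φ ψ} → ⟦_⟧ T φ ⊆ ⟦_⟧ T ψ → Gset T φ ⊆ Gset T ψ
  ⟦⟧⊆⇒G⊆ h g with h (inj₁ g)
  ... | inj₁ g'             = g'
  ... | inj₂ (_ , not-dia)  = ⊥-elim (not-dia (proj₁ g))

  G⊆⇒⟦⟧⊆ : ∀ {φ ψ} → Gset T φ ⊆ Gset T ψ → ⟦_⟧ T φ ⊆ ⟦_⟧ T ψ
  G⊆⇒⟦⟧⊆ h (inj₁ g)      = inj₁ (h g)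
  G⊆⇒⟦⟧⊆ h (inj₂ bullet) = inj₂ bullet

  ⟦∧⟧≐∩ : ∀ {φ ψ} → TCirc T φ → TCirc T ψ → ⟦_⟧ T (φ ∧' ψ) ≐ (⟦_⟧ T φ ∩ ⟦_⟧ T ψ)
  ⟦∧⟧≐∩ {φ} {ψ} pφ pψ = split , join
    where
      split : ⟦_⟧ T (φ ∧' ψ) ⊆ (⟦_⟧ T φ ∩ ⟦_⟧ T ψ)
      split γ = ⟦⟧-mono (derivation (lb₁ (elem φ pφ) (elem ψ pψ))) γ
              , ⟦⟧-mono (derivation (lb₂ (elem φ pφ) (elem ψ pψ))) γ

      join : (⟦_⟧ T φ ∩ ⟦_⟧ T ψ) ⊆ ⟦_⟧ T (φ ∧' ψ)
      join (inj₁ (dia , d) , inj₁ (_ , e)) = inj₁ (dia , node (antecedent∈ d) (c-and pφ pψ) (∧R d e))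
      join (inj₁ _ , inj₂ bullet)          = inj₂ bullet
      join (inj₂ bullet , _)               = inj₂ bullet

  ≤°⇔⊆ : ∀ {φ ψ} → TCirc T φ → TCirc T ψ → (_≤°_ T φ ψ) ⇔ (⟦_⟧ T φ ⊆ ⟦_⟧ T ψ)
  ≤°⇔⊆ pφ pψ = ≐∩⇒[≐⇔⊆] (⟦∧⟧≐∩ pφ pψ)

  diamonds : List Fm
  diamonds = concatMap (λ χ → map (λ k → ◇^ k χ) (upTo 4)) T

  diamonds-sound : ∀ {φ} → φ ∈ diamonds → TDia T φ
  diamonds-sound m
    with χ , χ∈T , φ∈ ← find (∈-concatMap⁻ (λ χ → map (λ k → ◇^ k χ) (upTo 4)) {xs = T} m)
    with k , k∈ , refl ← ∈-map⁻ (λ k → ◇^ k χ) φ∈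
    = χ , χ∈T , k , ≤-pred (∈-upTo⁻ k∈) , refl

  diamonds-complete : ∀ {φ} → TDia T φ → φ ∈ diamonds
  diamonds-complete (χ , χ∈T , k , k≤3 , refl) =
    ∈-concatMap⁺ (λ χ → map (λ k → ◇^ k χ) (upTo 4))
                 (lose χ∈T (∈-map⁺ (λ k → ◇^ k χ) (∈-upTo⁺ (s≤s k≤3))))

module Finiteness (T : List Fm) (top∈T : top ∈ T) (bot∈T : bot ∈ T) where

  open Denotations T
  open Lattice (TCirc T) c-and c-or
  open Boolean (base (top , top∈T , 0 , z≤n , refl)) (base (bot , bot∈T , 0 , z≤n , refl)) c-neg

  atoms : List Elem
  atoms = mapWith∈ diamonds (λ m → elem _ (base (diamonds-sound m)))

  normalForm : ∀ {χ} → TCirc T χ → Tree atoms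
  normalForm (base dia)  = select (mapWith∈⁺ _ (_ , diamonds-complete dia , refl))
  normalForm (c-neg p)   = ¬ᵗ (normalForm p)
  normalForm (c-and p q) = normalForm p ∧ᵗ normalForm q
  normalForm (c-or p q)  = normalForm p ∨ᵗ normalForm q

  normalForm-sound : ∀ {χ} (p : TCirc T χ) → ⌊ normalForm p ⌋ ≈ elem χ p
  normalForm-sound (base dia)  = select-sound _ (base dia)
  normalForm-sound (c-neg p)   =
    ≈-trans (¬ᵗ-sound (normalForm p)) (∁-cong (normalForm-sound p))
  normalForm-sound (c-and p q) =
    ≈-trans (∧ᵗ-sound (normalForm p) (normalForm q)) (⊓-cong (normalForm-sound p) (normalForm-sound q))
  normalForm-sound (c-or p q)  =
    ≈-trans (∨ᵗ-sound (normalForm p) (normalForm q)) (⊔-cong (normalForm-sound p) (normalForm-sound q))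

  finiteDenotations : FiniteDenotations T
  finiteDenotations = map (formula ∘ ⌊_⌋) (trees atoms) , in-T° , represented
    where
      in-T° : ∀ {χ} → χ ∈ map (formula ∘ ⌊_⌋) (trees atoms) → TCirc T χ
      in-T° m with t , _ , refl ← ∈-map⁻ (formula ∘ ⌊_⌋) m = member ⌊ t ⌋

      represented : ∀ χ → TCirc T χ →
        Σ Fm λ χ' → (χ' ∈ map (formula ∘ ⌊_⌋) (trees atoms)) × (⟦_⟧ T χ ≐ ⟦_⟧ T χ')
      represented χ p =
        formula ⌊ normalForm p ⌋ ,
        ∈-map⁺ (formula ∘ ⌊_⌋) (trees-complete (normalForm p)) ,
        ⟦⟧-mono (derivation (proj₂ (normalForm-sound p))) ,
        ⟦⟧-mono (derivation (proj₁ (normalForm-sound p)))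

lemma3p5 : (T : List Fm) → top ∈ T → bot ∈ T →
    FiniteDenotations T ×
    (∀ φ ψ → TCirc T φ → TCirc T ψ →
      ((⟦_⟧ T φ ⊆ ⟦_⟧ T ψ) ⇔ (Gset T φ ⊆ Gset T ψ)) ×
      (TCirc T ⊢ ⟨ φ ⟩^ 0 ⇒ ψ → ⟦_⟧ T φ ⊆ ⟦_⟧ T ψ) ×
      ((_≤°_ T φ ψ) ⇔ (⟦_⟧ T φ ⊆ ⟦_⟧ T ψ)) ×
      (⟦_⟧ T (φ ∧' ψ) ≐ (⟦_⟧ T φ ∩ ⟦_⟧ T ψ)))
lemma3p5 T top∈T bot∈T =
  finiteDenotations ,
  λ φ ψ pφ pψ → mk⇔ ⟦⟧⊆⇒G⊆ G⊆⇒⟦⟧⊆ , ⟦⟧-mono , ≤°⇔⊆ pφ pψ , ⟦∧⟧≐∩ pφ pψ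
  where
    open Denotations T
    open Finiteness T top∈T bot∈T
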